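{- Let $n \geq 5$ be an integer and let $f$ be a $\gamma_R$-function of $P(n,2)$ such that, writing $V_i = \{v : f(v) = i\}$ for $i=0,1,2$, the set $V_2$ has minimum cardinality among all $\gamma_R$-functions of $P(n,2)$ (i.e. $|V_2| \leq |V_2'|$ for every $\gamma_R$-function $f'$ with $V_2' = \{v : f'(v)=2\}$). If $w_1 \in V_2$ and $w_2$ is a neighbor of $w_1$, then $w_2 \notin V_2$.
   Context: For integers $n$ and $k$, the generalized Petersen graph $P(n,k)$ is the graph with vertex set $\{v_i, u_i : 0 \leq i \leq n-1\}$ and edge set $\{v_i v_{i+1}, v_i u_i, u_i u_{i+k} : 0 \leq i \leq n-1\}$, subscripts taken modulo $n$. A Roman domination function (RDF) on a graph $G$ is a function $f: V(G) \to \{0,1,2\}$ such that every vertex $u$ with $f(u)=0$ is adjacent to at least one vertex $v$ with $f(v)=2$. Its weight is $\sum_{u \in V(G)} f(u)$. The Roman domination number $\gamma_R(G)$ is the minimum weight of an RDF on $G$, and a $\gamma_R$-function is an RDF of weight $\gamma_R(G)$. -}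

module Defs where

open import Data.Nat using (ℕ; zero; suc; _+_)
open import Data.Nat.DivMod using (_mod_)
open import Data.Fin using (Fin; toℕ)
open import Data.Fin.Patterns using (0F; 1F; 2F)
open import Data.Sum using (_⊎_; inj₁; inj₂)
open import Data.Nat.ListAction using (sum)
open import Data.List using (List; map; length; filter; _++_; allFin)
open import Data.Product using (_×_; ∃)
open import Relation.Binary.PropositionalEquality using (_≡_; _≢_)
open import Relation.Nullary using (¬_)
open import Data.Fin using (_≟_)

plusMod : {n : ℕ} → Fin n → ℕ → Fin n
plusMod {zero} ()
plusMod {suc m} i k = (toℕ i + k) mod (suc m)

-- Vertices of P(n,k): inj₁ i is v_i (outer), inj₂ i is u_i (inner)
Vertex : ℕ → Set
Vertex n = Fin n ⊎ Fin n

data Edge (n k : ℕ) : Vertex n → Vertex n → Set where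
  outer : (i : Fin n) → Edge n k (inj₁ i) (inj₁ (plusMod i 1))
  spoke : (i : Fin n) → Edge n k (inj₁ i) (inj₂ i)
  inner : (i : Fin n) → Edge n k (inj₂ i) (inj₂ (plusMod i k))

Adj : (n k : ℕ) → Vertex n → Vertex n → Set
Adj n k x y = Edge n k x y ⊎ Edge n k y x

Label : Set
Label = Fin 3

val : Label → ℕ
val 0F = 0
val 1F = 1
val 2F = 2

allVertices : (n : ℕ) → List (Vertex n)
allVertices n = map inj₁ (allFin n) ++ map inj₂ (allFin n)

IsRDF : (n k : ℕ) → (Vertex n → Label) → Set
IsRDF n k f = ∀ x → f x ≡ 0F → ∃ λ y → Adj n k x y × f y ≡ 2F

weight : (n : ℕ) → (Vertex n → Label) → ℕ
weight n f = sum (map (λ x → val (f x)) (allVertices n))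

IsGammaRFunction : (n k : ℕ) → (Vertex n → Label) → Set
IsGammaRFunction n k f =
  IsRDF n k f × (∀ g → IsRDF n k g → weight n f Data.Nat.≤ weight n g)

card2 : (n : ℕ) → (Vertex n → Label) → ℕ
card2 n f = length (filter (λ x → f x ≟ 2F) (allVertices n))

-- If f(w) = f(w') = 2 for adjacent w, w', relabel w to 0 and every neighbour of w carrying 0
-- to 1.  This is again a Roman domination function: w is dominated by w', and any other
-- vertex that stays at 0 was dominated by a vertex other than w.  Since P(n,k) is cubic and
-- the neighbour w' carries 2, at most two labels go up by 1 while w goes down by 2, so the
-- result is again a γ_R-function, with one vertex fewer labelled 2.
module Submission where

open import Defs
open import Data.Nat using (ℕ; zero; suc; _+_; _*_; _∸_; _≤_; _<_; z≤n; s≤s; _%_; _/_; NonZero)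
open import Data.Nat.Properties
  using (+-commutativeSemigroup; ≤-refl; ≤-reflexive; ≤-trans; <-irrefl; <⇒≤; <⇒≱;
         m≤m+n; m≤n+m; +-mono-≤; +-monoˡ-≤; +-identityʳ; +-assoc; +-cancelˡ-≡; +-cancelˡ-≤;
         m+[n∸m]≡n; module ≤-Reasoning)
open import Algebra.Properties.CommutativeSemigroup +-commutativeSemigroup using (interchange)
open import Data.Nat.DivMod
  using (%-distribˡ-+; m%n%n≡m%n; [m+n]%n≡m%n; m<n⇒m%n≡m; m≡m%n+[m/n]*n)
open import Data.Nat.ListAction using (sum)
open import Data.Fin using (Fin; toℕ; _≟_)
open import Data.Fin.Patterns using (0F; 1F; 2F)
open import Data.Fin.Properties using (toℕ-injective; toℕ-fromℕ<; toℕ<n)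
open import Data.List using (List; []; _∷_; map; length; filter; allFin)
open import Data.List.Membership.Propositional using (_∈_; _∉_)
open import Data.List.Membership.Propositional.Properties
  using (∈-allFin; ∈-map⁺; ∈-map⁻; ∈-++⁺ˡ; ∈-++⁺ʳ)
open import Data.List.Relation.Unary.All as All using (All)
open import Data.List.Relation.Unary.Any using (here; there)
open import Data.List.Relation.Unary.AllPairs using (_∷_)
open import Data.List.Relation.Unary.Unique.Propositional using (Unique)
open import Data.List.Relation.Unary.Unique.Propositional.Properties as Unique using (allFin⁺)
open import Data.Sum using (_⊎_; inj₁; inj₂; swap)
open import Data.Sum.Properties using (≡-dec; inj₁-injective; inj₂-injective)
open import Data.Product using (_×_; _,_; ∃; proj₁; proj₂)
open import Data.Empty using (⊥)
open import Function using (_∘_)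
open import Relation.Binary.Definitions using (DecidableEquality)
open import Relation.Binary.PropositionalEquality
open import Relation.Nullary using (¬_; Dec; yes; no; contradiction)
open import Relation.Nullary.Decidable using (_⊎-dec_)
open import Relation.Unary using (Pred; Decidable)

𝟙 : {P : Set} → Dec P → ℕ
𝟙 (yes _) = 1
𝟙 (no _)  = 0

𝟙≤1 : {P : Set} (d : Dec P) → 𝟙 d ≤ 1
𝟙≤1 (yes _) = ≤-refl
𝟙≤1 (no _)  = z≤n

𝟙-yes : {P : Set} (d : Dec P) → P → 𝟙 d ≡ 1
𝟙-yes (yes _) _ = refl
𝟙-yes (no ¬p) p = contradiction p ¬p

𝟙-no : {P : Set} (d : Dec P) → ¬ P → 𝟙 d ≡ 0
𝟙-no (yes p) ¬p = contradiction p ¬p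
𝟙-no (no _)  _  = refl

module _ {A : Set} where

  sum-map-+ : (h h′ : A → ℕ) (xs : List A) →
              sum (map (λ x → h x + h′ x) xs) ≡ sum (map h xs) + sum (map h′ xs)
  sum-map-+ h h′ []       = refl
  sum-map-+ h h′ (x ∷ xs) = trans (cong (h x + h′ x +_) (sum-map-+ h h′ xs))
                                  (interchange (h x) (h′ x) (sum (map h xs)) (sum (map h′ xs)))

  sum-map-mono-≤ : {h h′ : A → ℕ} → (∀ x → h x ≤ h′ x) →
                   (xs : List A) → sum (map h xs) ≤ sum (map h′ xs)
  sum-map-mono-≤ h≤h′ []       = z≤n
  sum-map-mono-≤ h≤h′ (x ∷ xs) = +-mono-≤ (h≤h′ x) (sum-map-mono-≤ h≤h′ xs)

  length-filter≡sum-𝟙 : {P : Pred A _} (P? : Decidable P) (xs : List A) →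
                        length (filter P? xs) ≡ sum (map (𝟙 ∘ P?) xs)
  length-filter≡sum-𝟙 P? []       = refl
  length-filter≡sum-𝟙 P? (x ∷ xs) with P? x
  ... | yes _ = cong suc (length-filter≡sum-𝟙 P? xs)
  ... | no _  = length-filter≡sum-𝟙 P? xs

module PointMass {A : Set} (_≟ₐ_ : DecidableEquality A) where

  δ : A → ℕ → A → ℕ
  δ c m x with x ≟ₐ c
  ... | yes _ = m
  ... | no _  = 0

  δ-self : ∀ c m → δ c m c ≡ m
  δ-self c m with c ≟ₐ c
  ... | yes _  = refl
  ... | no c≢c = contradiction refl c≢c

  δ-≢ : ∀ {c x} m → x ≢ c → δ c m x ≡ 0
  δ-≢ {c} {x} m x≢c with x ≟ₐ c
  ... | yes x≡c = contradiction x≡c x≢c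
  ... | no _    = refl

  sum-δ-∉ : ∀ {c} m (xs : List A) → c ∉ xs → sum (map (δ c m) xs) ≡ 0
  sum-δ-∉ m []       c∉xs = refl
  sum-δ-∉ m (x ∷ xs) c∉xs = cong₂ _+_
    (δ-≢ m λ { refl → c∉xs (here refl) }) (sum-δ-∉ m xs (c∉xs ∘ there))

  sum-δ : ∀ {c} m {xs : List A} → Unique xs → c ∈ xs → sum (map (δ c m) xs) ≡ m
  sum-δ m {c ∷ xs} (c∉xs ∷ _) (here refl) = begin
    δ c m c + sum (map (δ c m) xs) ≡⟨ cong₂ _+_ (δ-self c m) (sum-δ-∉ m xs c∉xs′) ⟩
    m + 0                          ≡⟨ +-identityʳ m ⟩
    m                              ∎
    where
    open ≡-Reasoning
    c∉xs′ : c ∉ xs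
    c∉xs′ c∈xs = All.lookup c∉xs c∈xs refl
  sum-δ m {x ∷ xs} (x∉xs ∷ u) (there c∈xs) =
    cong₂ _+_ (δ-≢ m (All.lookup x∉xs c∈xs)) (sum-δ m u c∈xs)

m+[n+o]≤2 : ∀ {m n o} → m ≤ 1 → n ≤ 1 → o ≤ 1 → m ≡ 0 ⊎ n ≡ 0 ⊎ o ≡ 0 → m + (n + o) ≤ 2
m+[n+o]≤2 _   n≤1 o≤1 (inj₁ refl)        = +-mono-≤ n≤1 o≤1
m+[n+o]≤2 m≤1 _   o≤1 (inj₂ (inj₁ refl)) = +-mono-≤ m≤1 o≤1
m+[n+o]≤2 {m} {n} m≤1 n≤1 _ (inj₂ (inj₂ refl)) =
  subst (λ p → m + p ≤ 2) (sym (+-identityʳ n)) (+-mono-≤ m≤1 n≤1)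


_≟ᵥ_ : ∀ {n} → DecidableEquality (Vertex n)
_≟ᵥ_ = ≡-dec _≟_ _≟_

∈-allVertices : ∀ {n} (x : Vertex n) → x ∈ allVertices n
∈-allVertices {n} (inj₁ i) = ∈-++⁺ˡ (∈-map⁺ inj₁ (∈-allFin i))
∈-allVertices {n} (inj₂ i) = ∈-++⁺ʳ (map inj₁ (allFin n)) (∈-map⁺ inj₂ (∈-allFin i))

allVertices-unique : ∀ n → Unique (allVertices n)
allVertices-unique n = Unique.++⁺ (Unique.map⁺ inj₁-injective (allFin⁺ n))
                                  (Unique.map⁺ inj₂-injective (allFin⁺ n)) disjoint
  where
  disjoint : ∀ {v} → ¬ (v ∈ map inj₁ (allFin n) × v ∈ map inj₂ (allFin n))
  disjoint (v∈₁ , v∈₂) with ∈-map⁻ inj₁ v∈₁ | ∈-map⁻ inj₂ v∈₂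
  ... | _ , _ , refl | _ , _ , ()

[m%n+k]%n≡[m+k]%n : ∀ m k n .{{_ : NonZero n}} → (m % n + k) % n ≡ (m + k) % n
[m%n+k]%n≡[m+k]%n m k n = begin
  (m % n + k) % n         ≡⟨ %-distribˡ-+ (m % n) k n ⟩
  (m % n % n + k % n) % n ≡⟨ cong (λ r → (r + k % n) % n) (m%n%n≡m%n m n) ⟩
  (m % n + k % n) % n     ≡⟨ %-distribˡ-+ m k n ⟨
  (m + k) % n             ∎
  where open ≡-Reasoning

toℕ-plusMod : ∀ {m} (i : Fin (suc m)) k → toℕ (plusMod i k) ≡ (toℕ i + k) % suc m
toℕ-plusMod i k = toℕ-fromℕ< _

plusMod-∸-inverse : ∀ {n} (i : Fin n) k → k ≤ n → plusMod (plusMod i k) (n ∸ k) ≡ i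
plusMod-∸-inverse {suc m} i k k≤n = toℕ-injective (begin
  toℕ (plusMod (plusMod i k) (n ∸ k)) ≡⟨ toℕ-plusMod (plusMod i k) (n ∸ k) ⟩
  (toℕ (plusMod i k) + (n ∸ k)) % n   ≡⟨ cong (λ r → (r + (n ∸ k)) % n) (toℕ-plusMod i k) ⟩
  ((toℕ i + k) % n + (n ∸ k)) % n     ≡⟨ [m%n+k]%n≡[m+k]%n (toℕ i + k) (n ∸ k) n ⟩
  (toℕ i + k + (n ∸ k)) % n           ≡⟨ cong (_% n) (+-assoc (toℕ i) k (n ∸ k)) ⟩
  (toℕ i + (k + (n ∸ k))) % n         ≡⟨ cong (λ r → (toℕ i + r) % n) (m+[n∸m]≡n k≤n) ⟩
  (toℕ i + n) % n                     ≡⟨ [m+n]%n≡m%n (toℕ i) n ⟩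
  toℕ i % n                           ≡⟨ m<n⇒m%n≡m (toℕ<n i) ⟩
  toℕ i                               ∎)
  where
  open ≡-Reasoning
  n = suc m

-- If i + k ≡ i (mod n) then k is a multiple of n, impossible for 0 < k < n.
plusMod-≢ : ∀ {n} (i : Fin n) {k} → 0 < k → k < n → plusMod i k ≢ i
plusMod-≢ {suc m} i {k} 0<k k<n i+k≡i = multiple-impossible ((toℕ i + k) / n) k≡q*n
  where
  n = suc m
  k≡q*n : k ≡ ((toℕ i + k) / n) * n
  k≡q*n = +-cancelˡ-≡ (toℕ i) k _ (trans (m≡m%n+[m/n]*n (toℕ i + k) n)
            (cong (_+ ((toℕ i + k) / n) * n) (trans (sym (toℕ-plusMod i k)) (cong toℕ i+k≡i))))
  multiple-impossible : ∀ q → k ≡ q * n → ⊥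
  multiple-impossible zero    refl = <-irrefl refl 0<k
  multiple-impossible (suc q) refl = <⇒≱ k<n (m≤m+n n (q * n))

module Petersen {n k : ℕ} (0<k : 0 < k) (k<n : k < n) where

  step⁺ step⁻ across : Vertex n → Vertex n
  step⁺ (inj₁ i) = inj₁ (plusMod i 1)
  step⁺ (inj₂ i) = inj₂ (plusMod i k)
  step⁻ (inj₁ i) = inj₁ (plusMod i (n ∸ 1))
  step⁻ (inj₂ i) = inj₂ (plusMod i (n ∸ k))
  across (inj₁ i) = inj₂ i
  across (inj₂ i) = inj₁ i

  Neighbour : Vertex n → Vertex n → Set
  Neighbour w x = x ≡ step⁺ w ⊎ x ≡ across w ⊎ x ≡ step⁻ w

  neighbour? : ∀ w x → Dec (Neighbour w x)
  neighbour? w x = (x ≟ᵥ step⁺ w) ⊎-dec ((x ≟ᵥ across w) ⊎-dec (x ≟ᵥ step⁻ w))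

  adj⇒neighbour : ∀ {x w} → Adj n k x w → Neighbour w x
  adj⇒neighbour (inj₁ (outer j)) =
    inj₂ (inj₂ (cong inj₁ (sym (plusMod-∸-inverse j 1 (≤-trans 0<k (<⇒≤ k<n))))))
  adj⇒neighbour (inj₁ (spoke j)) = inj₂ (inj₁ refl)
  adj⇒neighbour (inj₁ (inner j)) = inj₂ (inj₂ (cong inj₂ (sym (plusMod-∸-inverse j k (<⇒≤ k<n)))))
  adj⇒neighbour (inj₂ (outer i)) = inj₁ refl
  adj⇒neighbour (inj₂ (spoke i)) = inj₂ (inj₁ refl)
  adj⇒neighbour (inj₂ (inner i)) = inj₁ refl

  edge-irrefl : ∀ {x y} → Edge n k x y → x ≢ y
  edge-irrefl (outer i) eq = plusMod-≢ i ≤-refl (≤-trans (s≤s 0<k) k<n) (sym (inj₁-injective eq))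
  edge-irrefl (inner i) eq = plusMod-≢ i 0<k k<n (sym (inj₂-injective eq))

  adj-irrefl : ∀ {x y} → Adj n k x y → x ≢ y
  adj-irrefl (inj₁ e) = edge-irrefl e
  adj-irrefl (inj₂ e) = edge-irrefl e ∘ sym

  open PointMass (_≟ᵥ_ {n})

  Σᵥ : (Vertex n → ℕ) → ℕ
  Σᵥ h = sum (map h (allVertices n))

  Σᵥ-+ : (h h′ : Vertex n → ℕ) → Σᵥ (λ x → h x + h′ x) ≡ Σᵥ h + Σᵥ h′
  Σᵥ-+ h h′ = sum-map-+ h h′ (allVertices n)

  Σᵥ-mono-≤ : {h h′ : Vertex n → ℕ} → (∀ x → h x ≤ h′ x) → Σᵥ h ≤ Σᵥ h′
  Σᵥ-mono-≤ h≤h′ = sum-map-mono-≤ h≤h′ (allVertices n)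

  card2≡Σᵥ : ∀ g → card2 n g ≡ Σᵥ (λ x → 𝟙 (g x ≟ 2F))
  card2≡Σᵥ g = length-filter≡sum-𝟙 (λ x → g x ≟ 2F) (allVertices n)

  Σᵥ-δ : ∀ c m → Σᵥ (δ c m) ≡ m
  Σᵥ-δ c m = sum-δ m (allVertices-unique n) (∈-allVertices c)

  module Demote (f : Vertex n → Label) (w : Vertex n) where

    demote : Vertex n → Label
    demote x with x ≟ᵥ w | f x ≟ 0F | neighbour? w x
    ... | yes _ | _     | _     = 0F
    ... | no _  | yes _ | yes _ = 1F
    ... | no _  | _     | _     = f x

    demote-cases : (P : Vertex n → Label → Set) (x : Vertex n) →
                   (x ≡ w → P x 0F) →
                   (x ≢ w → f x ≡ 0F → Neighbour w x → P x 1F) →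
                   (x ≢ w → ¬ (f x ≡ 0F × Neighbour w x) → P x (f x)) →
                   P x (demote x)
    demote-cases P x self raise keep with x ≟ᵥ w | f x ≟ 0F | neighbour? w x
    ... | yes x≡w | _        | _       = self x≡w
    ... | no x≢w  | yes fx≡0 | yes x~w = raise x≢w fx≡0 x~w
    ... | no x≢w  | yes _    | no x≁w  = keep x≢w (x≁w ∘ proj₂)
    ... | no x≢w  | no fx≢0  | _       = keep x≢w (fx≢0 ∘ proj₁)

    demote-keeps-2 : ∀ {y} → f y ≡ 2F → y ≢ w → demote y ≡ 2F
    demote-keeps-2 {y} fy≡2 y≢w = demote-cases (λ _ l → l ≡ 2F) y
      (λ y≡w → contradiction y≡w y≢w)
      (λ _ fy≡0 _ → contradiction (trans (sym fy≡2) fy≡0) λ ())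
      (λ _ _ → fy≡2)

    demote-isRDF : ∀ {w′} → IsRDF n k f → f w′ ≡ 2F → Adj n k w′ w → IsRDF n k demote
    demote-isRDF {w′} rdf fw′≡2 w′~w x = demote-cases (λ x l → l ≡ 0F → Dominated x) x
      (λ { refl _ → w′ , swap w′~w , demote-keeps-2 fw′≡2 (adj-irrefl w′~w) })
      (λ _ _ _ ())
      (λ _ x≁w fx≡0 → dominated-away-from-w fx≡0 (λ x~w → x≁w (fx≡0 , x~w)))
      where
      Dominated : Vertex n → Set
      Dominated x = ∃ λ y → Adj n k x y × demote y ≡ 2F
      dominated-away-from-w : f x ≡ 0F → ¬ Neighbour w x → Dominated x
      dominated-away-from-w fx≡0 x≁w with rdf x fx≡0
      ... | y , x~y , fy≡2 = y , x~y , demote-keeps-2 fy≡2 λ { refl → x≁w (adj⇒neighbour x~y) }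

    zero? : Vertex n → ℕ
    zero? c = 𝟙 (f c ≟ 0F)

    mass : Vertex n → Vertex n → ℕ
    mass c = δ c (zero? c)

    -- Bounds the labels raised from 0 to 1; a neighbour listed twice is merely overcounted.
    raised : Vertex n → ℕ
    raised x = mass (step⁺ w) x + (mass (across w) x + mass (step⁻ w) x)

    mass-self : ∀ {c} → f c ≡ 0F → mass c c ≡ 1
    mass-self {c} fc≡0 = trans (δ-self c (zero? c)) (𝟙-yes _ fc≡0)

    zero?-2 : ∀ {c} → f c ≡ 2F → zero? c ≡ 0
    zero?-2 fc≡2 = 𝟙-no _ λ fc≡0 → contradiction (trans (sym fc≡2) fc≡0) λ ()

    raised-neighbour : ∀ {x} → Neighbour w x → f x ≡ 0F → 1 ≤ raised x
    raised-neighbour {x} (inj₁ refl) fx≡0 = begin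
      1                   ≡⟨ mass-self fx≡0 ⟨
      mass (step⁺ w) x    ≤⟨ m≤m+n _ _ ⟩
      raised x            ∎
      where open ≤-Reasoning
    raised-neighbour {x} (inj₂ (inj₁ refl)) fx≡0 = begin
      1                                       ≡⟨ mass-self fx≡0 ⟨
      mass (across w) x                       ≤⟨ m≤m+n _ (mass (step⁻ w) x) ⟩
      mass (across w) x + mass (step⁻ w) x    ≤⟨ m≤n+m _ (mass (step⁺ w) x) ⟩
      raised x                                ∎
      where open ≤-Reasoning
    raised-neighbour {x} (inj₂ (inj₂ refl)) fx≡0 = begin
      1                                       ≡⟨ mass-self fx≡0 ⟨
      mass (step⁻ w) x                        ≤⟨ m≤n+m _ (mass (across w) x) ⟩
      mass (across w) x + mass (step⁻ w) x    ≤⟨ m≤n+m _ (mass (step⁺ w) x) ⟩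
      raised x                                ∎
      where open ≤-Reasoning

    Σᵥ-raised≤2 : ∀ {w′} → f w′ ≡ 2F → Adj n k w′ w → Σᵥ raised ≤ 2
    Σᵥ-raised≤2 fw′≡2 w′~w = begin
      Σᵥ raised
        ≡⟨ Σᵥ-+ _ _ ⟩
      Σᵥ (mass (step⁺ w)) + Σᵥ (λ x → mass (across w) x + mass (step⁻ w) x)
        ≡⟨ cong₂ _+_ (Σᵥ-δ _ _) (Σᵥ-+ _ _) ⟩
      zero? (step⁺ w) + (Σᵥ (mass (across w)) + Σᵥ (mass (step⁻ w)))
        ≡⟨ cong (zero? (step⁺ w) +_) (cong₂ _+_ (Σᵥ-δ _ _) (Σᵥ-δ _ _)) ⟩
      zero? (step⁺ w) + (zero? (across w) + zero? (step⁻ w))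
        ≤⟨ m+[n+o]≤2 (𝟙≤1 _) (𝟙≤1 _) (𝟙≤1 _) some-zero? ⟩
      2 ∎
      where
      open ≤-Reasoning
      some-zero? : zero? (step⁺ w) ≡ 0 ⊎ zero? (across w) ≡ 0 ⊎ zero? (step⁻ w) ≡ 0
      some-zero? with adj⇒neighbour w′~w
      ... | inj₁ refl        = inj₁ (zero?-2 fw′≡2)
      ... | inj₂ (inj₁ refl) = inj₂ (inj₁ (zero?-2 fw′≡2))
      ... | inj₂ (inj₂ refl) = inj₂ (inj₂ (zero?-2 fw′≡2))

    δ-off-w : ∀ {x} m a b → x ≢ w → δ w m x + a ≤ b + a
    δ-off-w m a b x≢w = subst (λ d → d + a ≤ b + a) (sym (δ-≢ m x≢w)) (m≤n+m a b)

    weight-pointwise : f w ≡ 2F → ∀ x → δ w 2 x + val (demote x) ≤ raised x + val (f x)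
    weight-pointwise fw≡2 x = demote-cases (λ x l → δ w 2 x + val l ≤ raised x + val (f x)) x
      (λ { refl → begin
        δ w 2 w + 0          ≡⟨ cong (_+ 0) (δ-self w 2) ⟩
        2                    ≤⟨ m≤n+m 2 (raised w) ⟩
        raised w + 2         ≡⟨ cong (λ l → raised w + val l) fw≡2 ⟨
        raised w + val (f w) ∎ })
      (λ x≢w fx≡0 x~w → begin
        δ w 2 x + 1          ≡⟨ cong (_+ 1) (δ-≢ 2 x≢w) ⟩
        1                    ≤⟨ raised-neighbour x~w fx≡0 ⟩
        raised x             ≡⟨ +-identityʳ (raised x) ⟨
        raised x + 0         ≡⟨ cong (λ l → raised x + val l) fx≡0 ⟨
        raised x + val (f x) ∎)
      (λ x≢w _ → δ-off-w 2 _ _ x≢w)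
      where open ≤-Reasoning

    V₂-pointwise : f w ≡ 2F → ∀ x → δ w 1 x + 𝟙 (demote x ≟ 2F) ≤ 𝟙 (f x ≟ 2F)
    V₂-pointwise fw≡2 x = demote-cases (λ x l → δ w 1 x + 𝟙 (l ≟ 2F) ≤ 𝟙 (f x ≟ 2F)) x
      (λ { refl → ≤-reflexive (trans (cong (_+ 0) (δ-self w 1)) (sym (𝟙-yes _ fw≡2))) })
      (λ x≢w _ _ → ≤-trans (≤-reflexive (cong (_+ 0) (δ-≢ 1 x≢w))) z≤n)
      (λ x≢w _ → δ-off-w 1 _ 0 x≢w)

    weight-demote≤ : ∀ {w′} → f w ≡ 2F → f w′ ≡ 2F → Adj n k w′ w →
                     weight n demote ≤ weight n f
    weight-demote≤ fw≡2 fw′≡2 w′~w = +-cancelˡ-≤ 2 _ _ (begin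
      2 + weight n demote                        ≡⟨ cong (_+ weight n demote) (Σᵥ-δ w 2) ⟨
      Σᵥ (δ w 2) + weight n demote               ≡⟨ Σᵥ-+ _ _ ⟨
      Σᵥ (λ x → δ w 2 x + val (demote x))        ≤⟨ Σᵥ-mono-≤ (weight-pointwise fw≡2) ⟩
      Σᵥ (λ x → raised x + val (f x))            ≡⟨ Σᵥ-+ _ _ ⟩
      Σᵥ raised + weight n f                     ≤⟨ +-monoˡ-≤ (weight n f) (Σᵥ-raised≤2 fw′≡2 w′~w) ⟩
      2 + weight n f                             ∎)
      where open ≤-Reasoning

    card2-demote< : f w ≡ 2F → card2 n demote < card2 n f
    card2-demote< fw≡2 = begin
      1 + card2 n demote                         ≡⟨ cong (1 +_) (card2≡Σᵥ demote) ⟩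
      1 + Σᵥ (λ x → 𝟙 (demote x ≟ 2F))          ≡⟨ cong (_+ Σᵥ (λ x → 𝟙 (demote x ≟ 2F))) (Σᵥ-δ w 1) ⟨
      Σᵥ (δ w 1) + Σᵥ (λ x → 𝟙 (demote x ≟ 2F)) ≡⟨ Σᵥ-+ _ _ ⟨
      Σᵥ (λ x → δ w 1 x + 𝟙 (demote x ≟ 2F))    ≤⟨ Σᵥ-mono-≤ (V₂-pointwise fw≡2) ⟩
      Σᵥ (λ x → 𝟙 (f x ≟ 2F))                   ≡⟨ card2≡Σᵥ f ⟨
      card2 n f                                  ∎
      where open ≤-Reasoning

    demote-isGammaRFunction : ∀ {w′} → IsGammaRFunction n k f → f w ≡ 2F →
                              f w′ ≡ 2F → Adj n k w′ w → IsGammaRFunction n k demote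
    demote-isGammaRFunction (rdf , minimal) fw≡2 fw′≡2 w′~w =
      demote-isRDF rdf fw′≡2 w′~w ,
      λ g g-rdf → ≤-trans (weight-demote≤ fw≡2 fw′≡2 w′~w) (minimal g g-rdf)

lemma2p3 : (n : ℕ) → 5 ≤ n → (f : Vertex n → Label)
    → IsGammaRFunction n 2 f
    → (∀ g → IsGammaRFunction n 2 g → card2 n f ≤ card2 n g)
    → (w₁ w₂ : Vertex n) → f w₁ ≡ 2F → Adj n 2 w₁ w₂ → f w₂ ≢ 2F
lemma2p3 n 5≤n f γ V₂-minimal w₁ w₂ fw₁≡2 w₁~w₂ fw₂≡2 =
  <⇒≱ (card2-demote< fw₂≡2) (V₂-minimal demote (demote-isGammaRFunction γ fw₂≡2 fw₁≡2 w₁~w₂))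
  where
  open Petersen {n} {2} (s≤s z≤n) (≤-trans (s≤s (s≤s (s≤s z≤n))) 5≤n)
  open Demote f w₂
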